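{- Work in the ring $\mathbb{Z}/4\mathbb{Z}$. (i) Let $n\ge2$ be an even integer and $(\bar a_1,\ldots,\bar a_n)$ an $n$-tuple with all entries in $\{\bar0,\bar2\}$. Then there exists $(\bar x,\bar y)\in\{\bar0,\bar2\}^2$ such that $(\bar x,\bar a_1,\ldots,\bar a_n,\bar y)$ is a $\lambda$-quiddity over $\mathbb{Z}/4\mathbb{Z}$. In particular: for every $n$-tuple $(\bar a_1,\ldots,\bar a_n)$ with entries in $\{\bar0,\bar2\}$, $K_n(\bar a_1,\ldots,\bar a_n)=\pm\bar1$; and there are exactly $2^{n-2}$ $\lambda$-quiddities over $\mathbb{Z}/4\mathbb{Z}$ of size $n$ with all entries in $\{\bar0,\bar2\}$. (ii) Let $n\ge1$ with $n\equiv1\pmod 3$ and let $(\bar a_1,\ldots,\bar a_n)$ be an $n$-tuple with all entries in $\{\bar1,-\bar1\}$. Then there exists $(\bar x,\bar y)\in\{ -\bar1,\bar1\}^2$ such that $(\bar x,\bar a_1,\ldots,\bar a_n,\bar y)$ is a $\lambda$-quiddity over $\mathbb{Z}/4\mathbb{Z}$. In particular: for every $n\equiv1\pmod3$ and every $n$-tuple $(\bar a_1,\ldots,\bar a_n)$ with entries in $\{\pm\bar1\}$, $K_n(\bar a_1,\ldots,\bar a_n)=\pm\bar1$; and for every positive integer $n\equiv0\pmod3$ there are exactly $2^{n-2}$ $\lambda$-quiddities over $\mathbb{Z}/4\mathbb{Z}$ of size $n$ with all entries in $\{\bar1,-\bar1\}$.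
   Context: For a commutative unital ring $A$ and $a_1,\ldots,a_n\in A$, set $M_n(a_1,\ldots,a_n)=\begin{pmatrix}a_n&-1\\1&0\end{pmatrix}\cdots\begin{pmatrix}a_1&-1\\1&0\end{pmatrix}$. An $n$-tuple $(a_1,\ldots,a_n)\in A^n$ is a $\lambda$-quiddity over $A$ of size $n$ if $M_n(a_1,\ldots,a_n)=\pm Id$. The continuant $K_i(a_1,\ldots,a_i)$ (for $i\ge1$) is the determinant of the $i\times i$ tridiagonal matrix with diagonal entries $a_1,\ldots,a_i$ and all sub- and super-diagonal entries equal to $1$; $K_0=1$, $K_{ -1}=0$. Here $\bar a$ denotes the class of an integer $a$ modulo $4$. -}

module Defs where

open import Data.Nat as ℕ using (ℕ; zero; suc)
open import Data.Fin as Fin using (Fin; zero; suc; toℕ; punchIn)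
open import Data.Vec as Vec using (Vec; []; _∷_; _∷ʳ_)
open import Data.Vec.Relation.Unary.All as All using (All)
open import Data.List as List using (List)
open import Data.Sum using (_⊎_; inj₁; inj₂)
open import Data.Product using (_×_; _,_)
open import Relation.Nullary using (Dec; yes; no; ¬_)
open import Relation.Binary.PropositionalEquality using (_≡_; refl)

data Z4 : Set where
  z0 z1 z2 z3 : Z4

fromℕ : ℕ → Z4
fromℕ 0 = z0
fromℕ 1 = z1
fromℕ 2 = z2
fromℕ 3 = z3
fromℕ (suc (suc (suc (suc n)))) = fromℕ n

rep : Z4 → ℕ
rep z0 = 0
rep z1 = 1
rep z2 = 2
rep z3 = 3

infixl 6 _+₄_ _-₄_
infixl 7 _*₄_

_+₄_ : Z4 → Z4 → Z4
a +₄ b = fromℕ (rep a ℕ.+ rep b)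

_*₄_ : Z4 → Z4 → Z4
a *₄ b = fromℕ (rep a ℕ.* rep b)

-₄_ : Z4 → Z4
-₄ a = fromℕ (4 ℕ.∸ rep a)

_-₄_ : Z4 → Z4 → Z4
a -₄ b = a +₄ (-₄ b)

_≟₄_ : (a b : Z4) → Dec (a ≡ b)
z0 ≟₄ z0 = yes refl
z0 ≟₄ z1 = no λ ()
z0 ≟₄ z2 = no λ ()
z0 ≟₄ z3 = no λ ()
z1 ≟₄ z0 = no λ ()
z1 ≟₄ z1 = yes refl
z1 ≟₄ z2 = no λ ()
z1 ≟₄ z3 = no λ ()
z2 ≟₄ z0 = no λ ()
z2 ≟₄ z1 = no λ ()
z2 ≟₄ z2 = yes refl
z2 ≟₄ z3 = no λ ()
z3 ≟₄ z0 = no λ ()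
z3 ≟₄ z1 = no λ ()
z3 ≟₄ z2 = no λ ()
z3 ≟₄ z3 = yes refl

record Mat₂ : Set where
  constructor mat
  field
    m₁₁ m₁₂ m₂₁ m₂₂ : Z4
open Mat₂ public

_·_ : Mat₂ → Mat₂ → Mat₂
mat a b c d · mat e f g h =
  mat (a *₄ e +₄ b *₄ g) (a *₄ f +₄ b *₄ h)
      (c *₄ e +₄ d *₄ g) (c *₄ f +₄ d *₄ h)

Id : Mat₂
Id = mat z1 z0 z0 z1

-Id : Mat₂
-Id = mat (-₄ z1) z0 z0 (-₄ z1)

E : Z4 → Mat₂
E a = mat a (-₄ z1) z1 z0

M : ∀ {n} → Vec Z4 n → Mat₂
M []       = Id
M (a ∷ as) = M as · E a

IsQuiddity : ∀ {n} → Vec Z4 n → Set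
IsQuiddity as = M as ≡ Id ⊎ M as ≡ -Id

_≟M_ : (A B : Mat₂) → Dec (A ≡ B)
mat a b c d ≟M mat e f g h with a ≟₄ e | b ≟₄ f | c ≟₄ g | d ≟₄ h
... | yes refl | yes refl | yes refl | yes refl = yes refl
... | no p | _ | _ | _ = no λ { refl → p refl }
... | yes _ | no p | _ | _ = no λ { refl → p refl }
... | yes _ | yes _ | no p | _ = no λ { refl → p refl }
... | yes _ | yes _ | yes _ | no p = no λ { refl → p refl }

isQuiddity? : ∀ {n} (as : Vec Z4 n) → Dec (IsQuiddity as)
isQuiddity? as with M as ≟M Id | M as ≟M -Id
... | yes p | _ = yes (inj₁ p)
... | no _ | yes q = yes (inj₂ q)
... | no p | no q = no λ { (inj₁ x) → p x ; (inj₂ x) → q x }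

IsEven₄ : Z4 → Set
IsEven₄ a = a ≡ z0 ⊎ a ≡ z2

IsUnitPM : Z4 → Set
IsUnitPM a = a ≡ z1 ⊎ a ≡ -₄ z1

dec⊎ : ∀ {A B : Set} → Dec A → Dec B → Dec (A ⊎ B)
dec⊎ (yes a) _ = yes (inj₁ a)
dec⊎ (no _) (yes b) = yes (inj₂ b)
dec⊎ (no p) (no q) = no λ { (inj₁ x) → p x ; (inj₂ x) → q x }

dec× : ∀ {A B : Set} → Dec A → Dec B → Dec (A × B)
dec× (yes a) (yes b) = yes (a , b)
dec× (no p) _ = no λ { (x , _) → p x }
dec× (yes _) (no q) = no λ { (_ , y) → q y }

isEven₄? : ∀ a → Dec (IsEven₄ a)
isEven₄? a = dec⊎ (a ≟₄ z0) (a ≟₄ z2)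

isUnitPM? : ∀ a → Dec (IsUnitPM a)
isUnitPM? a = dec⊎ (a ≟₄ z1) (a ≟₄ (-₄ z1))

allZ4 : List Z4
allZ4 = z0 List.∷ z1 List.∷ z2 List.∷ z3 List.∷ List.[]

allVecs : (n : ℕ) → List (Vec Z4 n)
allVecs zero    = [] List.∷ List.[]
allVecs (suc n) = List.concatMap (λ a → List.map (a ∷_) (allVecs n)) allZ4

countQuiddities : (n : ℕ) {P : Z4 → Set} → (∀ a → Dec (P a)) → ℕ
countQuiddities n P? =
  List.length (List.filter (λ v → dec× (isQuiddity? v) (All.all? P? v)) (allVecs n))

sum₄ : ∀ {n} → (Fin n → Z4) → Z4
sum₄ {zero}  f = z0
sum₄ {suc n} f = f zero +₄ sum₄ (λ i → f (suc i))

sign : ℕ → Z4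
sign zero = z1
sign (suc zero) = -₄ z1
sign (suc (suc k)) = sign k

det : (n : ℕ) → (Fin n → Fin n → Z4) → Z4
det zero    A = z1
det (suc n) A = sum₄ (λ j → sign (toℕ j) *₄ A zero j *₄ det n (λ i k → A (suc i) (punchIn j k)))

tridiag : ∀ {n} → Vec Z4 n → Fin n → Fin n → Z4
tridiag as i j with toℕ i ℕ.≟ toℕ j | suc (toℕ i) ℕ.≟ toℕ j | toℕ i ℕ.≟ suc (toℕ j)
... | yes _ | _ | _ = Vec.lookup as i
... | no _ | yes _ | _ = z1
... | no _ | no _ | yes _ = z1
... | no _ | no _ | no _ = z0

K : ∀ {n} → Vec Z4 n → Z4
K {n} as = det n (tridiag as)

-- M_n(a₁,…,a_n) = E(a_n)⋯E(a₁) is built letter by letter, so the values it takes on words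
-- with letters in a fixed class form "layers" of 2×2 matrices over ℤ/4ℤ, each obtained from
-- the previous one by right multiplication.  These finite layers are eventually periodic
-- (period 4 from length 2 for letters in {0̄, 2̄}; period 3 from length 3 for letters in
-- {±1̄}, as sets).  Completing a word to a λ-quiddity is thus a finite check on a few layers;
-- counting λ-quiddities uses that every matrix of a layer is reached from the previous layer
-- in the same number of ways, so the number of words with a given product is a power of 2
-- times the multiplicity of that product in its layer.  Finally K(a₁,…,a_n) is the top-left
-- entry of M_n, and bordering by E(x), E(y) turns it into minus the bottom-right entry of
-- M_{n+2}, which is ±1̄ for a λ-quiddity.

module Submission where

open import Defs
open import Data.Nat as ℕ using (ℕ; zero; suc; _+_; _*_; _^_; _∸_; _%_; _≥_)
open import Data.Nat.Properties using (+-identityʳ; +-suc; *-assoc; *-comm; *-identityˡ; *-identityʳ; *-distribˡ-+; *-zeroʳ)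
open import Data.Nat.Divisibility using (divides)
open import Data.Nat.DivMod using (%-remove-+ˡ)
open import Data.Nat.ListAction using (sum)
open import Data.Fin using (Fin; zero; suc; toℕ; punchIn)
open import Data.Vec using (Vec; []; _∷_; _∷ʳ_; lookup)
open import Data.Vec.Relation.Unary.All as All using (All; []; _∷_)
open import Data.List using (List; []; _∷_; _++_; map; filter; concatMap; deduplicate; length)
open import Data.List.Properties using (map-cong; filter-++; length-++; filter-≐; filter-none)
import Data.List.Relation.Unary.All as ListAll
import Data.List.Relation.Unary.Any as Any
open import Data.List.Relation.Unary.Any.Properties using (deduplicate⁺)
open import Data.List.Membership.Propositional using (_∈_)
open import Data.List.Membership.Propositional.Properties using (∈-concatMap⁺; ∈-map⁺; ∈-filter⁺)
open import Data.Bool using (true; false)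
open import Data.Empty using (⊥-elim)
open import Data.Product using (_×_; ∃; ∃₂; _,_)
open import Data.Sum as Sum using (_⊎_; inj₁; inj₂; [_,_])
open import Function using (_∘_)
open import Relation.Nullary using (Dec; yes; no; ¬_; does)
open import Relation.Nullary.Decidable using (from-yes; map′; _×-dec_; _⊎-dec_)
open import Relation.Unary using (Pred; Decidable)
open import Relation.Binary.PropositionalEquality using (_≡_; _≢_; refl; sym; trans; cong; cong₂; subst; module ≡-Reasoning)

all? : {P : Z4 → Set} → Decidable P → Dec (∀ a → P a)
all? P? = map′ (λ (p₀ , p₁ , p₂ , p₃) → λ { z0 → p₀ ; z1 → p₁ ; z2 → p₂ ; z3 → p₃ })
               (λ h → h z0 , h z1 , h z2 , h z3)
               (P? z0 ×-dec P? z1 ×-dec P? z2 ×-dec P? z3)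

any? : {P : Z4 → Set} → Decidable P → Dec (∃ P)
any? P? = map′ [ (z0 ,_) , [ (z1 ,_) , [ (z2 ,_) , (z3 ,_) ] ] ]
               (λ { (z0 , p) → inj₁ p ; (z1 , p) → inj₂ (inj₁ p)
                  ; (z2 , p) → inj₂ (inj₂ (inj₁ p)) ; (z3 , p) → inj₂ (inj₂ (inj₂ p)) })
               (P? z0 ⊎-dec P? z1 ⊎-dec P? z2 ⊎-dec P? z3)

+₄-assoc : ∀ a b c → (a +₄ b) +₄ c ≡ a +₄ (b +₄ c)
+₄-assoc = from-yes (all? λ a → all? λ b → all? λ c → ((a +₄ b) +₄ c) ≟₄ (a +₄ (b +₄ c)))

+₄-comm : ∀ a b → a +₄ b ≡ b +₄ a
+₄-comm = from-yes (all? λ a → all? λ b → (a +₄ b) ≟₄ (b +₄ a))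

*₄-assoc : ∀ a b c → (a *₄ b) *₄ c ≡ a *₄ (b *₄ c)
*₄-assoc = from-yes (all? λ a → all? λ b → all? λ c → ((a *₄ b) *₄ c) ≟₄ (a *₄ (b *₄ c)))

*₄-distribˡ-+₄ : ∀ a b c → a *₄ (b +₄ c) ≡ a *₄ b +₄ a *₄ c
*₄-distribˡ-+₄ = from-yes (all? λ a → all? λ b → all? λ c → (a *₄ (b +₄ c)) ≟₄ (a *₄ b +₄ a *₄ c))

*₄-distribʳ-+₄ : ∀ a b c → (a +₄ b) *₄ c ≡ a *₄ c +₄ b *₄ c
*₄-distribʳ-+₄ = from-yes (all? λ a → all? λ b → all? λ c → ((a +₄ b) *₄ c) ≟₄ (a *₄ c +₄ b *₄ c))

*₄-identityˡ : ∀ a → z1 *₄ a ≡ a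
*₄-identityˡ = from-yes (all? λ a → (z1 *₄ a) ≟₄ a)

*₄-zeroʳ : ∀ a → a *₄ z0 ≡ z0
*₄-zeroʳ = from-yes (all? λ a → (a *₄ z0) ≟₄ z0)

+₄-interchange : ∀ a b c d → (a +₄ b) +₄ (c +₄ d) ≡ (a +₄ c) +₄ (b +₄ d)
+₄-interchange a b c d = begin
  (a +₄ b) +₄ (c +₄ d) ≡⟨ +₄-assoc a b (c +₄ d) ⟩
  a +₄ (b +₄ (c +₄ d)) ≡⟨ cong (a +₄_) (sym (+₄-assoc b c d)) ⟩
  a +₄ ((b +₄ c) +₄ d) ≡⟨ cong (λ t → a +₄ (t +₄ d)) (+₄-comm b c) ⟩
  a +₄ ((c +₄ b) +₄ d) ≡⟨ cong (a +₄_) (+₄-assoc c b d) ⟩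
  a +₄ (c +₄ (b +₄ d)) ≡⟨ sym (+₄-assoc a c (b +₄ d)) ⟩
  (a +₄ c) +₄ (b +₄ d) ∎
  where open ≡-Reasoning

allᴹ? : {P : Mat₂ → Set} → Decidable P → Dec (∀ X → P X)
allᴹ? P? = map′ (λ h X → h (m₁₁ X) (m₁₂ X) (m₂₁ X) (m₂₂ X)) (λ h a b c d → h (mat a b c d))
                (all? λ a → all? λ b → all? λ c → all? λ d → P? (mat a b c d))

row·col-assoc : ∀ a b e f g h i k →
  (a *₄ e +₄ b *₄ g) *₄ i +₄ (a *₄ f +₄ b *₄ h) *₄ k ≡ a *₄ (e *₄ i +₄ f *₄ k) +₄ b *₄ (g *₄ i +₄ h *₄ k)
row·col-assoc a b e f g h i k = begin
  (a *₄ e +₄ b *₄ g) *₄ i +₄ (a *₄ f +₄ b *₄ h) *₄ k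
    ≡⟨ cong₂ _+₄_ (*₄-distribʳ-+₄ (a *₄ e) (b *₄ g) i) (*₄-distribʳ-+₄ (a *₄ f) (b *₄ h) k) ⟩
  (a *₄ e *₄ i +₄ b *₄ g *₄ i) +₄ (a *₄ f *₄ k +₄ b *₄ h *₄ k)
    ≡⟨ +₄-interchange (a *₄ e *₄ i) (b *₄ g *₄ i) (a *₄ f *₄ k) (b *₄ h *₄ k) ⟩
  (a *₄ e *₄ i +₄ a *₄ f *₄ k) +₄ (b *₄ g *₄ i +₄ b *₄ h *₄ k)
    ≡⟨ cong₂ _+₄_ (cong₂ _+₄_ (*₄-assoc a e i) (*₄-assoc a f k))
                  (cong₂ _+₄_ (*₄-assoc b g i) (*₄-assoc b h k)) ⟩
  (a *₄ (e *₄ i) +₄ a *₄ (f *₄ k)) +₄ (b *₄ (g *₄ i) +₄ b *₄ (h *₄ k))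
    ≡⟨ sym (cong₂ _+₄_ (*₄-distribˡ-+₄ a (e *₄ i) (f *₄ k)) (*₄-distribˡ-+₄ b (g *₄ i) (h *₄ k))) ⟩
  a *₄ (e *₄ i +₄ f *₄ k) +₄ b *₄ (g *₄ i +₄ h *₄ k) ∎
  where open ≡-Reasoning

·-assoc : ∀ X Y Z → (X · Y) · Z ≡ X · (Y · Z)
·-assoc (mat a b c d) (mat e f g h) (mat i j k l)
  rewrite row·col-assoc a b e f g h i k | row·col-assoc a b e f g h j l
        | row·col-assoc c d e f g h i k | row·col-assoc c d e f g h j l = refl

·-identityˡ : ∀ X → Id · X ≡ X
·-identityˡ = from-yes (allᴹ? λ X → (Id · X) ≟M X)

·-identityʳ : ∀ X → X · Id ≡ X
·-identityʳ = from-yes (allᴹ? λ X → (X · Id) ≟M X)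

E⁻¹ : Z4 → Mat₂
E⁻¹ a = mat z0 z1 (-₄ z1) a

E·E⁻¹ : ∀ a → E a · E⁻¹ a ≡ Id
E·E⁻¹ = from-yes (all? λ a → (E a · E⁻¹ a) ≟M Id)

E⁻¹·E : ∀ a → E⁻¹ a · E a ≡ Id
E⁻¹·E = from-yes (all? λ a → (E⁻¹ a · E a) ≟M Id)

·E≡⇒≡·E⁻¹ : ∀ {X Y} a → X · E a ≡ Y → X ≡ Y · E⁻¹ a
·E≡⇒≡·E⁻¹ {X} {Y} a eq = begin
  X               ≡⟨ sym (·-identityʳ X) ⟩
  X · Id          ≡⟨ cong (X ·_) (sym (E·E⁻¹ a)) ⟩
  X · (E a · E⁻¹ a) ≡⟨ sym (·-assoc X (E a) (E⁻¹ a)) ⟩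
  (X · E a) · E⁻¹ a ≡⟨ cong (_· E⁻¹ a) eq ⟩
  Y · E⁻¹ a         ∎
  where open ≡-Reasoning

≡·E⁻¹⇒·E≡ : ∀ {X Y} a → X ≡ Y · E⁻¹ a → X · E a ≡ Y
≡·E⁻¹⇒·E≡ {X} {Y} a refl = begin
  (Y · E⁻¹ a) · E a ≡⟨ ·-assoc Y (E⁻¹ a) (E a) ⟩
  Y · (E⁻¹ a · E a) ≡⟨ cong (Y ·_) (E⁻¹·E a) ⟩
  Y · Id          ≡⟨ ·-identityʳ Y ⟩
  Y               ∎
  where open ≡-Reasoning

M-∷ʳ : ∀ {n} (as : Vec Z4 n) y → M (as ∷ʳ y) ≡ E y · M as
M-∷ʳ []       y = trans (·-identityˡ (E y)) (sym (·-identityʳ (E y)))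
M-∷ʳ (a ∷ as) y = trans (cong (_· E a) (M-∷ʳ as y)) (·-assoc (E y) (M as) (E a))

-- Continuants

Matrix : ℕ → Set
Matrix n = Fin n → Fin n → Z4

minor : ∀ {n} → Fin (suc n) → Matrix (suc n) → Matrix n
minor j A i k = A (suc i) (punchIn j k)

sum₄-zero : ∀ {n} {f : Fin n → Z4} → (∀ i → f i ≡ z0) → sum₄ f ≡ z0
sum₄-zero {zero}  _ = refl
sum₄-zero {suc n} h = cong₂ _+₄_ (h zero) (sum₄-zero (h ∘ suc))

sum₄-cong : ∀ {n} {f g : Fin n → Z4} → (∀ i → f i ≡ g i) → sum₄ f ≡ sum₄ g
sum₄-cong {zero}  _ = refl
sum₄-cong {suc n} h = cong₂ _+₄_ (h zero) (sum₄-cong (h ∘ suc))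

det-cong : ∀ n {A B : Matrix n} → (∀ i j → A i j ≡ B i j) → det n A ≡ det n B
det-cong zero    _ = refl
det-cong (suc n) h = sum₄-cong λ j →
  cong₂ (λ u v → sign (toℕ j) *₄ u *₄ v) (h zero j) (det-cong n λ i k → h (suc i) (punchIn j k))

det-zero-column : ∀ n (A : Matrix (suc n)) → (∀ i → A i zero ≡ z0) → det (suc n) A ≡ z0
det-zero-column zero    A col rewrite col zero = refl
det-zero-column (suc n) A col =
  cong₂ _+₄_ (cong (λ t → z1 *₄ t *₄ det (suc n) (minor zero A)) (col zero)) (sum₄-zero λ j →
    trans (cong (sign (toℕ (suc j)) *₄ A zero (suc j) *₄_) (det-zero-column n (minor (suc j) A) (col ∘ suc)))
          (*₄-zeroʳ (sign (toℕ (suc j)) *₄ A zero (suc j))))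

det-expand₂ : ∀ n (A : Matrix (suc (suc n))) → (∀ j → A zero (suc (suc j)) ≡ z0) →
  det (suc (suc n)) A ≡
    A zero zero *₄ det (suc n) (minor zero A) -₄ A zero (suc zero) *₄ det (suc n) (minor (suc zero) A)
det-expand₂ n A row =
  trans (cong (λ r → z1 *₄ x *₄ D₀ +₄ (-₄ z1 *₄ y *₄ D₁ +₄ r)) (sum₄-zero later-terms-vanish))
        (two-terms x y D₀ D₁)
  where
  x = A zero zero
  y = A zero (suc zero)
  D₀ = det (suc n) (minor zero A)
  D₁ = det (suc n) (minor (suc zero) A)
  later-terms-vanish : ∀ j → sign (toℕ j) *₄ A zero (suc (suc j)) *₄ det (suc n) (minor (suc (suc j)) A) ≡ z0
  later-terms-vanish j = cong (λ t → t *₄ det (suc n) (minor (suc (suc j)) A))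
    (trans (cong (sign (toℕ j) *₄_) (row j)) (*₄-zeroʳ (sign (toℕ j))))
  two-terms : ∀ x y D₀ D₁ → z1 *₄ x *₄ D₀ +₄ (-₄ z1 *₄ y *₄ D₁ +₄ z0) ≡ x *₄ D₀ -₄ y *₄ D₁
  two-terms = from-yes (all? λ x → all? λ y → all? λ D₀ → all? λ D₁ →
    (z1 *₄ x *₄ D₀ +₄ (-₄ z1 *₄ y *₄ D₁ +₄ z0)) ≟₄ (x *₄ D₀ -₄ y *₄ D₁))

band : ℕ → ℕ → Z4 → Z4
band (suc i)       (suc j)       d = band i j d
band zero          zero          d = d
band zero          (suc zero)    _ = z1
band zero          (suc (suc _)) _ = z0
band (suc zero)    zero          _ = z1
band (suc (suc _)) zero          _ = z0

band-diagonal : ∀ i d → band i i d ≡ d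
band-diagonal zero    d = refl
band-diagonal (suc i) d = band-diagonal i d

band-super : ∀ i d → band i (suc i) d ≡ z1
band-super zero    d = refl
band-super (suc i) d = band-super i d

band-sub : ∀ i d → band (suc i) i d ≡ z1
band-sub zero    d = refl
band-sub (suc i) d = band-sub i d

band-far : ∀ i j d → i ≢ j → suc i ≢ j → i ≢ suc j → band i j d ≡ z0
band-far zero          zero          d p q r = ⊥-elim (p refl)
band-far zero          (suc zero)    d p q r = ⊥-elim (q refl)
band-far zero          (suc (suc j)) d p q r = refl
band-far (suc zero)    zero          d p q r = ⊥-elim (r refl)
band-far (suc (suc i)) zero          d p q r = refl
band-far (suc i)       (suc j)       d p q r =
  band-far i j d (p ∘ cong suc) (q ∘ cong suc) (r ∘ cong suc)

Tri : ∀ {n} → Vec Z4 n → Matrix n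
Tri as i j = band (toℕ i) (toℕ j) (lookup as i)

tridiag≗Tri : ∀ {n} (as : Vec Z4 n) i j → tridiag as i j ≡ Tri as i j
tridiag≗Tri as i j with toℕ i ℕ.≟ toℕ j | suc (toℕ i) ℕ.≟ toℕ j | toℕ i ℕ.≟ suc (toℕ j)
... | yes p | _     | _     = sym (trans (cong (λ t → band (toℕ i) t (lookup as i)) (sym p)) (band-diagonal (toℕ i) _))
... | no _  | yes q | _     = sym (trans (cong (λ t → band (toℕ i) t (lookup as i)) (sym q)) (band-super (toℕ i) _))
... | no _  | no _  | yes r = sym (trans (cong (λ t → band t (toℕ j) (lookup as i)) r) (band-sub (toℕ j) _))
... | no p  | no q  | no r  = sym (band-far (toℕ i) (toℕ j) (lookup as i) p q r)

K≡detTri : ∀ {n} (as : Vec Z4 n) → K as ≡ det n (Tri as)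
K≡detTri {n} as = det-cong n (tridiag≗Tri as)

-- This minor has first column (1, 0, …, 0), so expanding along its first row leaves det (Tri as).
det-minor₁-Tri : ∀ {n} a b (as : Vec Z4 n) → det (suc n) (minor (suc zero) (Tri (a ∷ b ∷ as))) ≡ K as
det-minor₁-Tri a b []       = refl
det-minor₁-Tri {suc n} a b (c ∷ cs) = begin
  det (suc (suc n)) B                                  ≡⟨ det-expand₂ n B (λ _ → refl) ⟩
  z1 *₄ det (suc n) (Tri (c ∷ cs)) -₄ z1 *₄ det (suc n) (minor (suc zero) B)
    ≡⟨ cong (λ t → z1 *₄ det (suc n) (Tri (c ∷ cs)) -₄ z1 *₄ t) (det-zero-column n (minor (suc zero) B) (λ _ → refl)) ⟩
  z1 *₄ det (suc n) (Tri (c ∷ cs)) -₄ z1 *₄ z0        ≡⟨ unit-minus-zero (det (suc n) (Tri (c ∷ cs))) ⟩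
  det (suc n) (Tri (c ∷ cs))                           ≡⟨ sym (K≡detTri (c ∷ cs)) ⟩
  K (c ∷ cs)                                           ∎
  where
  open ≡-Reasoning
  B = minor (suc zero) (Tri (a ∷ b ∷ c ∷ cs))
  unit-minus-zero : ∀ x → z1 *₄ x -₄ z1 *₄ z0 ≡ x
  unit-minus-zero = from-yes (all? λ x → (z1 *₄ x -₄ z1 *₄ z0) ≟₄ x)

K-∷∷ : ∀ {n} a b (as : Vec Z4 n) → K (a ∷ b ∷ as) ≡ a *₄ K (b ∷ as) -₄ K as
K-∷∷ {n} a b as = begin
  K (a ∷ b ∷ as)                     ≡⟨ K≡detTri (a ∷ b ∷ as) ⟩
  det (suc (suc n)) (Tri (a ∷ b ∷ as)) ≡⟨ det-expand₂ n (Tri (a ∷ b ∷ as)) (λ _ → refl) ⟩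
  a *₄ det (suc n) (Tri (b ∷ as)) -₄ z1 *₄ det (suc n) (minor (suc zero) (Tri (a ∷ b ∷ as)))
    ≡⟨ cong₂ (λ u v → a *₄ u -₄ v) (sym (K≡detTri (b ∷ as))) (*₄-identityˡ (det (suc n) (minor (suc zero) (Tri (a ∷ b ∷ as))))) ⟩
  a *₄ K (b ∷ as) -₄ det (suc n) (minor (suc zero) (Tri (a ∷ b ∷ as)))
    ≡⟨ cong (λ t → a *₄ K (b ∷ as) -₄ t) (det-minor₁-Tri a b as) ⟩
  a *₄ K (b ∷ as) -₄ K as            ∎
  where open ≡-Reasoning

m₁₁-M : ∀ {n} (as : Vec Z4 n) → m₁₁ (M as) ≡ K as
m₁₁-M []           = refl
m₁₁-M (a ∷ [])     = from-yes (all? λ a → m₁₁ (M (a ∷ [])) ≟₄ K (a ∷ [])) a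
m₁₁-M (a ∷ b ∷ as) = begin
  m₁₁ (M (a ∷ b ∷ as))                ≡⟨ recurrence a (m₁₁ (M (b ∷ as))) (m₁₁ (M as)) (m₁₂ (M as)) ⟩
  a *₄ m₁₁ (M (b ∷ as)) -₄ m₁₁ (M as) ≡⟨ cong₂ (λ u v → a *₄ u -₄ v) (m₁₁-M (b ∷ as)) (m₁₁-M as) ⟩
  a *₄ K (b ∷ as) -₄ K as             ≡⟨ sym (K-∷∷ a b as) ⟩
  K (a ∷ b ∷ as)                      ∎
  where
  open ≡-Reasoning
  recurrence : ∀ a y z q → y *₄ a +₄ (z *₄ (-₄ z1) +₄ q *₄ z0) *₄ z1 ≡ a *₄ y -₄ z
  recurrence = from-yes (all? λ a → all? λ y → all? λ z → all? λ q →
    (y *₄ a +₄ (z *₄ (-₄ z1) +₄ q *₄ z0) *₄ z1) ≟₄ (a *₄ y -₄ z))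

m₂₂-bordered : ∀ x y X → m₂₂ ((E y · X) · E x) ≡ -₄ m₁₁ X
m₂₂-bordered x y = from-yes (allᴹ? λ X → m₂₂ ((E y · X) · E x) ≟₄ (-₄ m₁₁ X))

negate-±1 : ∀ p → -₄ p ≡ z1 ⊎ -₄ p ≡ -₄ z1 → p ≡ z1 ⊎ p ≡ -₄ z1
negate-±1 z0 (inj₁ ())
negate-±1 z0 (inj₂ ())
negate-±1 z1 _ = inj₁ refl
negate-±1 z2 (inj₁ ())
negate-±1 z2 (inj₂ ())
negate-±1 z3 _ = inj₂ refl

-- If M (x, as, y) = ± Id, its bottom-right entry is ± 1 and equals - K as.
quiddity⇒continuant-±1 : ∀ {n} (as : Vec Z4 n) {x y} → IsQuiddity (x ∷ (as ∷ʳ y)) → K as ≡ z1 ⊎ K as ≡ -₄ z1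
quiddity⇒continuant-±1 as {x} {y} q =
  subst (λ k → k ≡ z1 ⊎ k ≡ -₄ z1) (m₁₁-M as)
    (negate-±1 _ (Sum.map (trans (sym corner) ∘ cong m₂₂) (trans (sym corner) ∘ cong m₂₂) q))
  where
  corner : m₂₂ (M (x ∷ (as ∷ʳ y))) ≡ -₄ m₁₁ (M as)
  corner = trans (cong (λ Z → m₂₂ (Z · E x)) (M-∷ʳ as y)) (m₂₂-bordered x y (M as))

length-filter-map : ∀ {A B : Set} {ℓ} {Q : Pred B ℓ} (Q? : Decidable Q) (f : A → B) xs →
  length (filter Q? (map f xs)) ≡ length (filter (Q? ∘ f) xs)
length-filter-map Q? f []       = refl
length-filter-map Q? f (x ∷ xs) with does (Q? (f x))
... | true  = cong suc (length-filter-map Q? f xs)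
... | false = length-filter-map Q? f xs

length-filter-concatMap : ∀ {A B : Set} {ℓ} {Q : Pred B ℓ} (Q? : Decidable Q) (f : A → List B) xs →
  length (filter Q? (concatMap f xs)) ≡ sum (map (λ x → length (filter Q? (f x))) xs)
length-filter-concatMap Q? f []       = refl
length-filter-concatMap Q? f (x ∷ xs) = begin
  length (filter Q? (f x ++ concatMap f xs))                     ≡⟨ cong length (filter-++ Q? (f x) (concatMap f xs)) ⟩
  length (filter Q? (f x) ++ filter Q? (concatMap f xs))         ≡⟨ length-++ (filter Q? (f x)) ⟩
  length (filter Q? (f x)) + length (filter Q? (concatMap f xs)) ≡⟨ cong (length (filter Q? (f x)) +_) (length-filter-concatMap Q? f xs) ⟩
  length (filter Q? (f x)) + sum (map (λ x → length (filter Q? (f x))) xs) ∎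
  where open ≡-Reasoning

length-filter-⊎ : ∀ {A : Set} {ℓ} {Q Q₁ Q₂ : Pred A ℓ} (Q? : Decidable Q) (Q₁? : Decidable Q₁) (Q₂? : Decidable Q₂) →
  (∀ {x} → Q x → Q₁ x ⊎ Q₂ x) → (∀ {x} → Q₁ x ⊎ Q₂ x → Q x) → (∀ {x} → Q₁ x → ¬ Q₂ x) →
  ∀ xs → length (filter Q? xs) ≡ length (filter Q₁? xs) + length (filter Q₂? xs)
length-filter-⊎ Q? Q₁? Q₂? split join disjoint [] = refl
length-filter-⊎ Q? Q₁? Q₂? split join disjoint (x ∷ xs) with Q? x | Q₁? x | Q₂? x
... | yes _ | yes q₁ | yes q₂ = ⊥-elim (disjoint q₁ q₂)
... | yes _ | yes _  | no _   = cong suc (length-filter-⊎ Q? Q₁? Q₂? split join disjoint xs)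
... | yes _ | no _   | yes _  = trans (cong suc (length-filter-⊎ Q? Q₁? Q₂? split join disjoint xs)) (sym (+-suc _ _))
... | yes q | no ¬q₁ | no ¬q₂ = ⊥-elim ([ ¬q₁ , ¬q₂ ] (split q))
... | no ¬q | yes q₁ | _      = ⊥-elim (¬q (join (inj₁ q₁)))
... | no ¬q | no _   | yes q₂ = ⊥-elim (¬q (join (inj₂ q₂)))
... | no _  | no _   | no _   = length-filter-⊎ Q? Q₁? Q₂? split join disjoint xs

sum-map-filter : ∀ {A : Set} {ℓ} {Q : Pred A ℓ} (Q? : Decidable Q) {f g : A → ℕ} →
  (∀ {x} → Q x → f x ≡ g x) → (∀ {x} → ¬ Q x → f x ≡ 0) →
  ∀ xs → sum (map f xs) ≡ sum (map g (filter Q? xs))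
sum-map-filter Q? on off []       = refl
sum-map-filter Q? on off (x ∷ xs) with Q? x
... | yes q = cong₂ _+_ (on q) (sum-map-filter Q? on off xs)
... | no ¬q = cong₂ _+_ (off ¬q) (sum-map-filter Q? on off xs)

sum-map-*ˡ : ∀ {A : Set} k (f : A → ℕ) xs → sum (map (λ x → k * f x) xs) ≡ k * sum (map f xs)
sum-map-*ˡ k f []       = sym (*-zeroʳ k)
sum-map-*ˡ k f (x ∷ xs) = trans (cong (k * f x +_) (sum-map-*ˡ k f xs)) (sym (*-distribˡ-+ k (f x) _))

∈-allZ4 : ∀ a → a ∈ allZ4
∈-allZ4 z0 = Any.here refl
∈-allZ4 z1 = Any.there (Any.here refl)
∈-allZ4 z2 = Any.there (Any.there (Any.here refl))
∈-allZ4 z3 = Any.there (Any.there (Any.there (Any.here refl)))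

mult : Mat₂ → List Mat₂ → ℕ
mult Y L = length (filter (Y ≟M_) L)

Id≢-Id : Id ≢ -Id
Id≢-Id ()

-- Layers of products

module _ {P : Z4 → Set} (P? : Decidable P) where

  letters : List Z4
  letters = filter P? allZ4

  next : List Mat₂ → List Mat₂
  next L = deduplicate _≟M_ (concatMap (λ X → map (λ a → X · E a) letters) L)

  -- the values of M on words of length n with letters in P, without repetitions
  layer : ℕ → List Mat₂
  layer zero    = Id ∷ []
  layer (suc n) = next (layer n)

  ∈-next : ∀ {X L a} → X ∈ L → P a → X · E a ∈ next L
  ∈-next {X} {a = a} X∈L pa = deduplicate⁺ _≟M_ (λ { refl q → q })
    (∈-concatMap⁺ (λ Z → map (λ b → Z · E b) letters)
      (Any.map (λ { refl → ∈-map⁺ (λ b → X · E b) (∈-filter⁺ P? (∈-allZ4 a) pa) }) X∈L))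

  M∈layer : ∀ {n} {as : Vec Z4 n} → All P as → M as ∈ layer n
  M∈layer []       = Any.here refl
  M∈layer (p ∷ ps) = ∈-next (M∈layer ps) p

  wordCount : ℕ → Mat₂ → ℕ
  wordCount n Y = length (filter (λ v → dec× (M v ≟M Y) (All.all? P? v)) (allVecs n))

  countQuiddities≡wordCount± : ∀ n → countQuiddities n P? ≡ wordCount n Id + wordCount n -Id
  countQuiddities≡wordCount± n = length-filter-⊎ _ _ _
    (λ { (inj₁ e , ps) → inj₁ (e , ps) ; (inj₂ e , ps) → inj₂ (e , ps) })
    (λ { (inj₁ (e , ps)) → inj₁ e , ps ; (inj₂ (e , ps)) → inj₂ e , ps })
    (λ (e , _) (e′ , _) → Id≢-Id (trans (sym e) e′))
    (allVecs n)

  wordCount-zero : ∀ Y → wordCount zero Y ≡ mult Y (Id ∷ [])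
  wordCount-zero Y with Id ≟M Y | Y ≟M Id
  ... | yes _  | yes _  = refl
  ... | no  _  | no  _  = refl
  ... | yes e  | no ¬e  = ⊥-elim (¬e (sym e))
  ... | no ¬e  | yes e  = ⊥-elim (¬e (sym e))

  -- Splitting off the first letter a turns the condition M v · E a ≡ Y into M v ≡ Y · E⁻¹ a.
  wordCount-suc : ∀ n Y → wordCount (suc n) Y ≡ sum (map (λ a → wordCount n (Y · E⁻¹ a)) letters)
  wordCount-suc n Y = begin
    wordCount (suc n) Y
      ≡⟨ length-filter-concatMap Q? (λ a → map (a ∷_) (allVecs n)) allZ4 ⟩
    sum (map (λ a → length (filter Q? (map (a ∷_) (allVecs n)))) allZ4)
      ≡⟨ sum-map-filter P? first-letter no-first-letter allZ4 ⟩
    sum (map (λ a → wordCount n (Y · E⁻¹ a)) letters) ∎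
    where
    open ≡-Reasoning
    Q? = λ (v : Vec Z4 (suc n)) → dec× (M v ≟M Y) (All.all? P? v)
    first-letter : ∀ {a} → P a → length (filter Q? (map (a ∷_) (allVecs n))) ≡ wordCount n (Y · E⁻¹ a)
    first-letter {a} pa = trans (length-filter-map Q? (a ∷_) (allVecs n)) (cong length (filter-≐ _ _
      ((λ { (e , _ ∷ ps) → ·E≡⇒≡·E⁻¹ a e , ps }) , (λ (e , ps) → ≡·E⁻¹⇒·E≡ a e , pa ∷ ps)) (allVecs n)))
    no-first-letter : ∀ {a} → ¬ P a → length (filter Q? (map (a ∷_) (allVecs n))) ≡ 0
    no-first-letter {a} ¬pa = trans (length-filter-map Q? (a ∷_) (allVecs n))
      (cong length (filter-none _ (ListAll.universal (λ { _ (_ , pa ∷ _) → ¬pa pa }) (allVecs n))))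

  -- each matrix of next L is X · E a for exactly c pairs (X ∈ L, a ∈ letters)
  Uniform : ℕ → List Mat₂ → Set
  Uniform c L = ∀ Y → sum (map (λ a → mult (Y · E⁻¹ a) L) letters) ≡ c * mult Y (next L)

  uniform? : ∀ c L → Dec (Uniform c L)
  uniform? c L = allᴹ? λ Y → sum (map (λ a → mult (Y · E⁻¹ a) L) letters) ℕ.≟ c * mult Y (next L)

  wordCount≡mult-layer : (c w : ℕ → ℕ) → w zero ≡ 1 → (∀ k → w (suc k) ≡ c k * w k) →
    (∀ k → Uniform (c k) (layer k)) → ∀ n Y → wordCount n Y ≡ w n * mult Y (layer n)
  wordCount≡mult-layer c w w₀ wₛ uniform zero Y =
    trans (wordCount-zero Y) (sym (trans (cong (_* mult Y (Id ∷ [])) w₀) (*-identityˡ _)))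
  wordCount≡mult-layer c w w₀ wₛ uniform (suc k) Y = begin
    wordCount (suc k) Y                                          ≡⟨ wordCount-suc k Y ⟩
    sum (map (λ a → wordCount k (Y · E⁻¹ a)) letters)              ≡⟨ cong sum (map-cong (λ a → wordCount≡mult-layer c w w₀ wₛ uniform k (Y · E⁻¹ a)) letters) ⟩
    sum (map (λ a → w k * mult (Y · E⁻¹ a) (layer k)) letters)     ≡⟨ sum-map-*ˡ (w k) (λ a → mult (Y · E⁻¹ a) (layer k)) letters ⟩
    w k * sum (map (λ a → mult (Y · E⁻¹ a) (layer k)) letters)     ≡⟨ cong (w k *_) (uniform k Y) ⟩
    w k * (c k * mult Y (layer (suc k)))                         ≡⟨ sym (*-assoc (w k) (c k) _) ⟩
    w k * c k * mult Y (layer (suc k))                           ≡⟨ cong (_* mult Y (layer (suc k))) (trans (*-comm (w k) (c k)) (sym (wₛ k))) ⟩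
    w (suc k) * mult Y (layer (suc k))                           ∎
    where open ≡-Reasoning

  countQuiddities≡mult-layer : (c w : ℕ → ℕ) → w zero ≡ 1 → (∀ k → w (suc k) ≡ c k * w k) →
    (∀ k → Uniform (c k) (layer k)) →
    ∀ n → countQuiddities n P? ≡ w n * (mult Id (layer n) + mult -Id (layer n))
  countQuiddities≡mult-layer c w w₀ wₛ uniform n = begin
    countQuiddities n P?                                     ≡⟨ countQuiddities≡wordCount± n ⟩
    wordCount n Id + wordCount n -Id                         ≡⟨ cong₂ _+_ (count Id) (count -Id) ⟩
    w n * mult Id (layer n) + w n * mult -Id (layer n)       ≡⟨ sym (*-distribˡ-+ (w n) _ _) ⟩
    w n * (mult Id (layer n) + mult -Id (layer n))           ∎
    where
    open ≡-Reasoning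
    count = wordCount≡mult-layer c w w₀ wₛ uniform n

  layer-periodic : ∀ {p k₀} → layer (p + k₀) ≡ layer k₀ → ∀ j → layer (p + (k₀ + j)) ≡ layer (k₀ + j)
  layer-periodic {p} {k₀} eq zero    rewrite +-identityʳ k₀ = eq
  layer-periodic {p} {k₀} eq (suc j) rewrite +-suc k₀ j | +-suc p (k₀ + j) = cong next (layer-periodic {p} {k₀} eq j)

  Completable : Mat₂ → Set
  Completable X = ∃₂ λ x y → P x × P y × ((E y · X) · E x ≡ Id ⊎ (E y · X) · E x ≡ -Id)

  completable? : Decidable Completable
  completable? X = any? λ x → any? λ y →
    dec× (P? x) (dec× (P? y) (dec⊎ (((E y · X) · E x) ≟M Id) (((E y · X) · E x) ≟M -Id)))

  completion : ∀ {n} → ListAll.All Completable (layer n) → (as : Vec Z4 n) → All P as →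
    ∃₂ λ x y → P x × P y × IsQuiddity (x ∷ (as ∷ʳ y))
  completion completable as ps with ListAll.lookup completable (M∈layer ps)
  ... | x , y , px , py , q =
    x , y , px , py , subst (λ Z → Z ≡ Id ⊎ Z ≡ -Id) (sym (cong (_· E x) (M-∷ʳ as y))) q

-- Entries in {0̄, 2̄}

even-layer-periodic : ∀ j → layer isEven₄? (4 + (2 + j)) ≡ layer isEven₄? (2 + j)
even-layer-periodic = layer-periodic isEven₄? {4} {2} refl

%2-periodic : ∀ j → (4 + (2 + j)) % 2 ≡ (2 + j) % 2
%2-periodic j = %-remove-+ˡ {4} (2 + j) {2} (divides 2 refl)

on-even-layers : (Q : List Mat₂ → Set) → Q (layer isEven₄? 0) → Q (layer isEven₄? 2) → Q (layer isEven₄? 4) →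
  ∀ n → n % 2 ≡ 0 → Q (layer isEven₄? n)
on-even-layers Q q₀ q₂ q₄ 0 _ = q₀
on-even-layers Q q₀ q₂ q₄ 2 _ = q₂
on-even-layers Q q₀ q₂ q₄ 4 _ = q₄
on-even-layers Q q₀ q₂ q₄ 1 ()
on-even-layers Q q₀ q₂ q₄ 3 ()
on-even-layers Q q₀ q₂ q₄ 5 ()
on-even-layers Q q₀ q₂ q₄ (suc (suc (suc (suc (suc (suc j)))))) e =
  subst Q (sym (even-layer-periodic j))
    (on-even-layers Q q₀ q₂ q₄ (suc (suc j)) (trans (sym (%2-periodic j)) e))

even-completion : ∀ n → n % 2 ≡ 0 → (as : Vec Z4 n) → All IsEven₄ as →
  ∃₂ λ x y → IsEven₄ x × IsEven₄ y × IsQuiddity (x ∷ (as ∷ʳ y))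
even-completion n e = completion isEven₄? (on-even-layers (ListAll.All (Completable isEven₄?))
  (from-yes (all-completable 0)) (from-yes (all-completable 2)) (from-yes (all-completable 4)) n e)
  where
  all-completable : ∀ k → Dec (ListAll.All (Completable isEven₄?) (layer isEven₄? k))
  all-completable k = ListAll.all? (completable? isEven₄?) (layer isEven₄? k)

even-fan-in : ℕ → ℕ
even-fan-in 0               = 1
even-fan-in 1               = 1
even-fan-in (suc (suc _))   = 2

even-layers-uniform : ∀ k → Uniform isEven₄? (even-fan-in k) (layer isEven₄? k)
even-layers-uniform 0 = from-yes (uniform? isEven₄? 1 (layer isEven₄? 0))
even-layers-uniform 1 = from-yes (uniform? isEven₄? 1 (layer isEven₄? 1))
even-layers-uniform 2 = from-yes (uniform? isEven₄? 2 (layer isEven₄? 2))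
even-layers-uniform 3 = from-yes (uniform? isEven₄? 2 (layer isEven₄? 3))
even-layers-uniform 4 = from-yes (uniform? isEven₄? 2 (layer isEven₄? 4))
even-layers-uniform 5 = from-yes (uniform? isEven₄? 2 (layer isEven₄? 5))
even-layers-uniform (suc (suc (suc (suc (suc (suc j)))))) =
  subst (Uniform isEven₄? 2) (sym (even-layer-periodic j)) (even-layers-uniform (suc (suc j)))

even-count : ∀ n → n % 2 ≡ 0 → countQuiddities n isEven₄? ≡ 2 ^ (n ∸ 2)
even-count n e = begin
  countQuiddities n isEven₄?
    ≡⟨ countQuiddities≡mult-layer isEven₄? even-fan-in w refl w-suc even-layers-uniform n ⟩
  w n * (mult Id (layer isEven₄? n) + mult -Id (layer isEven₄? n))
    ≡⟨ cong (w n *_) (on-even-layers (λ L → mult Id L + mult -Id L ≡ 1) refl refl refl n e) ⟩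
  w n * 1
    ≡⟨ *-identityʳ (w n) ⟩
  2 ^ (n ∸ 2) ∎
  where
  open ≡-Reasoning
  w : ℕ → ℕ
  w k = 2 ^ (k ∸ 2)
  w-suc : ∀ k → w (suc k) ≡ even-fan-in k * w k
  w-suc 0             = refl
  w-suc 1             = refl
  w-suc (suc (suc k)) = refl

-- Entries in {1̄, -1̄}

-- As lists, with their order, these layers repeat only with period 6.
unit-layer-periodic : ∀ j → layer isUnitPM? (6 + (3 + j)) ≡ layer isUnitPM? (3 + j)
unit-layer-periodic = layer-periodic isUnitPM? {6} {3} refl

%3-periodic : ∀ j → (6 + (3 + j)) % 3 ≡ (3 + j) % 3
%3-periodic j = %-remove-+ˡ {6} (3 + j) {3} (divides 2 refl)

on-layers-≡1-mod-3 : (Q : List Mat₂ → Set) → Q (layer isUnitPM? 1) → Q (layer isUnitPM? 4) → Q (layer isUnitPM? 7) →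
  ∀ n → n % 3 ≡ 1 → Q (layer isUnitPM? n)
on-layers-≡1-mod-3 Q q₁ q₄ q₇ 1 _ = q₁
on-layers-≡1-mod-3 Q q₁ q₄ q₇ 4 _ = q₄
on-layers-≡1-mod-3 Q q₁ q₄ q₇ 7 _ = q₇
on-layers-≡1-mod-3 Q q₁ q₄ q₇ 0 ()
on-layers-≡1-mod-3 Q q₁ q₄ q₇ 2 ()
on-layers-≡1-mod-3 Q q₁ q₄ q₇ 3 ()
on-layers-≡1-mod-3 Q q₁ q₄ q₇ 5 ()
on-layers-≡1-mod-3 Q q₁ q₄ q₇ 6 ()
on-layers-≡1-mod-3 Q q₁ q₄ q₇ 8 ()
on-layers-≡1-mod-3 Q q₁ q₄ q₇ (suc (suc (suc (suc (suc (suc (suc (suc (suc j))))))))) e =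
  subst Q (sym (unit-layer-periodic j))
    (on-layers-≡1-mod-3 Q q₁ q₄ q₇ (suc (suc (suc j))) (trans (sym (%3-periodic j)) e))

on-layers-≡0-mod-3 : (Q : List Mat₂ → Set) → Q (layer isUnitPM? 3) → Q (layer isUnitPM? 6) →
  ∀ m → (3 + m) % 3 ≡ 0 → Q (layer isUnitPM? (3 + m))
on-layers-≡0-mod-3 Q q₃ q₆ 0 _ = q₃
on-layers-≡0-mod-3 Q q₃ q₆ 3 _ = q₆
on-layers-≡0-mod-3 Q q₃ q₆ 1 ()
on-layers-≡0-mod-3 Q q₃ q₆ 2 ()
on-layers-≡0-mod-3 Q q₃ q₆ 4 ()
on-layers-≡0-mod-3 Q q₃ q₆ 5 ()
on-layers-≡0-mod-3 Q q₃ q₆ (suc (suc (suc (suc (suc (suc j)))))) e =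
  subst Q (sym (unit-layer-periodic j)) (on-layers-≡0-mod-3 Q q₃ q₆ j (trans (sym (%3-periodic j)) e))

unit-completion : ∀ n → n % 3 ≡ 1 → (as : Vec Z4 n) → All IsUnitPM as →
  ∃₂ λ x y → IsUnitPM x × IsUnitPM y × IsQuiddity (x ∷ (as ∷ʳ y))
unit-completion n e = completion isUnitPM? (on-layers-≡1-mod-3 (ListAll.All (Completable isUnitPM?))
  (from-yes (all-completable 1)) (from-yes (all-completable 4)) (from-yes (all-completable 7)) n e)
  where
  all-completable : ∀ k → Dec (ListAll.All (Completable isUnitPM?) (layer isUnitPM? k))
  all-completable k = ListAll.all? (completable? isUnitPM?) (layer isUnitPM? k)

unit-fan-in : ℕ → ℕ
unit-fan-in 0                   = 1
unit-fan-in 1                   = 1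
unit-fan-in 2                   = 1
unit-fan-in (suc (suc (suc _))) = 2

unit-layers-uniform : ∀ k → Uniform isUnitPM? (unit-fan-in k) (layer isUnitPM? k)
unit-layers-uniform 0 = from-yes (uniform? isUnitPM? 1 (layer isUnitPM? 0))
unit-layers-uniform 1 = from-yes (uniform? isUnitPM? 1 (layer isUnitPM? 1))
unit-layers-uniform 2 = from-yes (uniform? isUnitPM? 1 (layer isUnitPM? 2))
unit-layers-uniform 3 = from-yes (uniform? isUnitPM? 2 (layer isUnitPM? 3))
unit-layers-uniform 4 = from-yes (uniform? isUnitPM? 2 (layer isUnitPM? 4))
unit-layers-uniform 5 = from-yes (uniform? isUnitPM? 2 (layer isUnitPM? 5))
unit-layers-uniform 6 = from-yes (uniform? isUnitPM? 2 (layer isUnitPM? 6))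
unit-layers-uniform 7 = from-yes (uniform? isUnitPM? 2 (layer isUnitPM? 7))
unit-layers-uniform 8 = from-yes (uniform? isUnitPM? 2 (layer isUnitPM? 8))
unit-layers-uniform (suc (suc (suc (suc (suc (suc (suc (suc (suc j))))))))) =
  subst (Uniform isUnitPM? 2) (sym (unit-layer-periodic j)) (unit-layers-uniform (suc (suc (suc j))))

unit-count : ∀ n → n ≥ 1 → n % 3 ≡ 0 → countQuiddities n isUnitPM? ≡ 2 ^ (n ∸ 2)
unit-count 0 () _
unit-count 1 _ ()
unit-count 2 _ ()
unit-count (suc (suc (suc m))) _ e = begin
  countQuiddities (3 + m) isUnitPM?
    ≡⟨ countQuiddities≡mult-layer isUnitPM? unit-fan-in w refl w-suc unit-layers-uniform (3 + m) ⟩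
  w (3 + m) * (mult Id (layer isUnitPM? (3 + m)) + mult -Id (layer isUnitPM? (3 + m)))
    ≡⟨ cong (w (3 + m) *_) (on-layers-≡0-mod-3 (λ L → mult Id L + mult -Id L ≡ 2) refl refl m e) ⟩
  2 ^ m * 2
    ≡⟨ *-comm (2 ^ m) 2 ⟩
  2 ^ (suc m) ∎
  where
  open ≡-Reasoning
  w : ℕ → ℕ
  w k = 2 ^ (k ∸ 3)
  w-suc : ∀ k → w (suc k) ≡ unit-fan-in k * w k
  w-suc 0                   = refl
  w-suc 1                   = refl
  w-suc 2                   = refl
  w-suc (suc (suc (suc k))) = refl

proposition4p4 :
    ((n : ℕ) → n ≥ 2 → n % 2 ≡ 0 → (as : Vec Z4 n) → All IsEven₄ as →
       ∃₂ λ x y → IsEven₄ x × IsEven₄ y × IsQuiddity (x ∷ (as ∷ʳ y)))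
    × ((n : ℕ) → n ≥ 2 → n % 2 ≡ 0 → (as : Vec Z4 n) → All IsEven₄ as →
       K as ≡ z1 ⊎ K as ≡ -₄ z1)
    × ((n : ℕ) → n ≥ 2 → n % 2 ≡ 0 →
       countQuiddities n isEven₄? ≡ 2 ^ (n ∸ 2))
    × ((n : ℕ) → n ≥ 1 → n % 3 ≡ 1 → (as : Vec Z4 n) → All IsUnitPM as →
       ∃₂ λ x y → IsUnitPM x × IsUnitPM y × IsQuiddity (x ∷ (as ∷ʳ y)))
    × ((n : ℕ) → n ≥ 1 → n % 3 ≡ 1 → (as : Vec Z4 n) → All IsUnitPM as →
       K as ≡ z1 ⊎ K as ≡ -₄ z1)
    × ((n : ℕ) → n ≥ 1 → n % 3 ≡ 0 →
       countQuiddities n isUnitPM? ≡ 2 ^ (n ∸ 2))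
-- The length bounds matter only for the count in (ii), which fails at n = 0.
proposition4p4 =
    (λ n _ e → even-completion n e)
  , (λ n _ e as ps → let (_ , _ , _ , _ , q) = even-completion n e as ps in quiddity⇒continuant-±1 as q)
  , (λ n _ → even-count n)
  , (λ n _ e → unit-completion n e)
  , (λ n _ e as ps → let (_ , _ , _ , _ , q) = unit-completion n e as ps in quiddity⇒continuant-±1 as q)
  , unit-count
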